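{- Let $A$ be a set and $s\colon M(A)\to L(A)$ a section of $q$. For all $x,y:A$, $x\le_s y$ holds if and only if $[x,y]\in\mathrm{im}(s)$.
   Context: Univalent type theory. $L(A)$ is the free monoid on $A$ (finite lists), $M(A)$ the free commutative monoid (finite multisets) with generators $\eta_A$, $\langle x,y\rangle=\eta_A(x)\cdot\eta_A(y)$, $q\colon L(A)\to M(A)$ the monoid homomorphism extending $\eta_A$; a section is $s$ with $q\circ s=\mathrm{id}$. $\mathrm{head}\colon L(A)\to1+A$ returns $\mathrm{inl}(\ast)$ on $[]$ and $\mathrm{inr}(x)$ on $x::xs$; $x\le_s y$ means $\mathrm{head}(s(\langle x,y\rangle))=\mathrm{inr}(x)$. $xs\in\mathrm{im}(s)$ means there merely exists $ys:M(A)$ with $s(ys)=xs$. -}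

module Defs where

open import Data.List using (List; []; _∷_; [_])
open import Data.Sum using (_⊎_; inj₁; inj₂)
open import Data.Unit using (⊤; tt)
open import Data.Product using (Σ; ∃)
open import Relation.Binary.PropositionalEquality using (_≡_)
open import Data.List.Relation.Binary.Permutation.Propositional using (_↭_)

L : Set → Set
L A = List A

-- M(A): free commutative monoid on A, modelled (no quotients in --without-K)
-- as the setoid of lists up to permutation: carrier List A, equality _↭_.
M : Set → Set
M A = List A

_≈M_ : {A : Set} → M A → M A → Set
_≈M_ = _↭_

η : {A : Set} → A → M A
η x = [ x ]

⟨_,_⟩ : {A : Set} → A → A → M A
⟨ x , y ⟩ = x ∷ y ∷ []

-- q : L(A) → M(A), the monoid hom extending η (on representatives: identity)
q : {A : Set} → L A → M A
q xs = xs

-- A section of q: a setoid morphism s : M(A) → L(A) (respects ↭, landing in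
-- L(A) with its propositional equality) with q ∘ s = id in M(A).
record Section (A : Set) : Set where
  field
    s       : M A → L A
    s-resp  : ∀ {m m′ : M A} → m ≈M m′ → s m ≡ s m′
    s-sec   : ∀ (m : M A) → q (s m) ≈M m

head : {A : Set} → L A → ⊤ ⊎ A
head []       = inj₁ tt
head (x ∷ _)  = inj₂ x

_≤[_]_ : {A : Set} → A → Section A → A → Set
x ≤[ σ ] y = head (Section.s σ ⟨ x , y ⟩) ≡ inj₂ x

-- xs ∈ im(s): there exists ys : M(A) with s ys = xs
-- (Σ instead of propositional truncation)
_∈im_ : {A : Set} → L A → Section A → Set
xs ∈im σ = Σ (M _) (λ ys → Section.s σ ys ≡ xs)

-- A permutation of [x, y] that starts with x is [x, y] itself, so x ≤ₛ y says exactly that s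
-- fixes ⟨x,y⟩.  And the image of a section s consists precisely of the lists fixed by s ∘ q:
-- if s m = xs then m ↭ q xs, and s respects ↭.
module Submission where

open import Defs
open import Data.List using (List; _∷_; [])
open import Data.Product using (_,_)
open import Data.Sum using (inj₂)
open import Data.Sum.Properties using (inj₂-injective)
open import Function.Bundles using (_⇔_; mk⇔)
open import Function.Properties.Equivalence as ⇔ using ()
open import Relation.Binary.PropositionalEquality using (_≡_; refl; cong; subst)
open import Data.List.Relation.Binary.Permutation.Propositional using (_↭_; ↭-sym)
open import Data.List.Relation.Binary.Permutation.Propositional.Properties
  using (drop-∷; ↭-singleton-inv; ↭-empty-inv)

↭-pair-headed : {A : Set} {x y : A} (xs : List A) →
  xs ↭ x ∷ y ∷ [] → head xs ≡ inj₂ x → xs ≡ x ∷ y ∷ []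
↭-pair-headed []      p _ with () ← ↭-empty-inv (↭-sym p)
↭-pair-headed (z ∷ _) p h with refl ← inj₂-injective h =
  cong (z ∷_) (↭-singleton-inv (drop-∷ p))

module _ {A : Set} (σ : Section A) where
  open Section σ

  ∈im⇔fixed : (xs : L A) → xs ∈im σ ⇔ s (q xs) ≡ xs
  ∈im⇔fixed xs = mk⇔ fixed (λ e → q xs , e)
    where
    fixed : xs ∈im σ → s (q xs) ≡ xs
    fixed (m , e) = subst (λ l → s (q l) ≡ l) e (s-resp (s-sec m))

  ≤⇔fixed : (x y : A) → x ≤[ σ ] y ⇔ s ⟨ x , y ⟩ ≡ x ∷ y ∷ []
  ≤⇔fixed x y = mk⇔ (↭-pair-headed _ (s-sec ⟨ x , y ⟩)) (λ e → cong head e)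

proposition58 : (A : Set) (σ : Section A) (x y : A) →
    (x ≤[ σ ] y) ⇔ ((x ∷ y ∷ []) ∈im σ)
proposition58 A σ x y = ⇔.trans (≤⇔fixed σ x y) (⇔.sym (∈im⇔fixed σ ⟨ x , y ⟩))
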